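{- There exists a set $S\subset\mathbb{R}^2$ that shatters nicely.
   Context: For real $x$, $R(x)=[x,\infty)$ and $L(x)=(-\infty,x]$ (the latter called left semi-infinite). $H=\{L(x)\}\cup\{R(x)\}\cup\{\mathbb{R}\}$, $H^d=\{I_1\times\dotsb\times I_d:I_j\in H\}$. For finite $A\subset\mathbb{R}^d$, $\mathrm{rect}(A)=\prod_{j=1}^d[\min_{a\in A}a_j,\max_{a\in A}a_j]$. For $d\ge2$, a set $S\subset\mathbb{R}^d$ shatters nicely if: (1) every $s\in S$ has $s_1=-s_2$; (2) the origin lies in $\mathrm{rect}(S)$; (3a) if $d$ is even, $|S|=\lfloor(3d+1)/2\rfloor-1$ and for every $A\subset S$ there is $I\in H^d$ with $S\cap I=A$, $0\in I$, and $I_1,I_2$ both left semi-infinite; (3b) if $d$ is odd, $|S|=\lfloor(3d+1)/2\rfloor-2$ and for every $A\subset S$ there is $I\in H^d$ with $S\cap I=A$, $0\in I$, and either $I_2=\mathbb{R}$ and $I_1,I_3$ are left semi-infinite, or $I_3=\mathbb{R}$ and $I_1,I_2$ are left semi-infinite. -}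

module Defs where

open import Data.Rational using (ℚ; -_; 0ℚ; _≤_; _⊓_; _⊔_)
open import Data.Product using (_×_; _,_; proj₁; proj₂; Σ; ∃)
open import Data.Unit using (⊤)
open import Data.Empty using (⊥)
open import Data.Fin using (Fin)
import Data.Nat as ℕ
open import Data.Fin.Subset using (Subset; _∈_)
open import Data.Vec using (Vec; lookup; map; foldr₁)
open import Function.Definitions using (Injective)
open import Function.Bundles using (_⇔_)
open import Relation.Binary.PropositionalEquality using (_≡_)

-- Real numbers are replaced by ℚ.
-- A point of the plane (d = 2), coordinates (s₁ , s₂).
Point : Set
Point = ℚ × ℚ

origin : Point
origin = 0ℚ , 0ℚ

data Half : Set where
  L    : ℚ → Half
  R    : ℚ → Half
  full : Half

_∈H_ : ℚ → Half → Set
x ∈H L a = x ≤ a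
x ∈H R a = a ≤ x
x ∈H full = ⊤

IsLeftSemiInfinite : Half → Set
IsLeftSemiInfinite (L _) = ⊤
IsLeftSemiInfinite (R _) = ⊥
IsLeftSemiInfinite full  = ⊥

Box : Set
Box = Half × Half

_∈B_ : Point → Box → Set
(x , y) ∈B (I₁ , I₂) = (x ∈H I₁) × (y ∈H I₂)

_∈rect_ : ∀ {m} → Point → Vec Point (ℕ.suc m) → Set
(x , y) ∈rect A =
  (foldr₁ _⊓_ (map proj₁ A) ≤ x × x ≤ foldr₁ _⊔_ (map proj₁ A)) ×
  (foldr₁ _⊓_ (map proj₂ A) ≤ y × y ≤ foldr₁ _⊔_ (map proj₂ A))

-- "S shatters nicely" for d = 2 (even case): |S| = ⌊(3·2+1)/2⌋ - 1 = 2.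
-- S is given as an injective enumeration Fin 2 → Point (so |S| = 2);
-- a subset A ⊆ S is a Subset 2 of the indices.
ShattersNicely2 : Vec Point 2 → Set
ShattersNicely2 S =
  Injective _≡_ _≡_ (lookup S) ×
  (∀ i → proj₁ (lookup S i) ≡ - proj₂ (lookup S i)) ×
  (origin ∈rect S) ×
  (∀ (A : Subset 2) → Σ Box λ I →
      (∀ i → ((lookup S i ∈B I) ⇔ (i ∈ A))) ×
      (origin ∈B I) ×
      IsLeftSemiInfinite (proj₁ I) ×
      IsLeftSemiInfinite (proj₂ I))

{-# OPTIONS --safe #-}
module Submission where

-- Take S = {(1,-1), (-1,1)}. Each point has one coordinate equal to -1, which every
-- quadrant L(0) or L(1) accepts, and one equal to 1, which L(1) accepts and L(0)
-- rejects. So the quadrant L(a₁) × L(a₂) with aᵢ = 1 exactly when the i-th point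
-- belongs to A cuts out A, and it always contains the origin.

open import Defs
open import Data.Product using (Σ; _,_; proj₁; proj₂)
open import Data.Vec using (Vec; _∷_; []; lookup)
open import Data.Vec.Properties using ([]=⇒lookup; lookup⇒[]=)
open import Data.Rational using (ℚ; 0ℚ; 1ℚ; -_; _≤_; _≤?_)
open import Data.Rational.Properties using (≤-refl; _≟_)
open import Data.Fin using (zero; suc)
open import Data.Fin.Subset using (Subset; Side; inside; outside; _∈_)
open import Data.Unit using (tt)
open import Function.Bundles using (_⇔_; mk⇔; Equivalence)
open import Function.Definitions using (Injective)
open import Relation.Nullary using (contradiction)
open import Relation.Nullary.Decidable using (from-yes; from-no)
open import Relation.Binary.PropositionalEquality using (_≡_; refl; cong)

open Equivalence using (to; from)

-1≤0 : - 1ℚ ≤ 0ℚ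
-1≤0 = from-yes (- 1ℚ ≤? 0ℚ)

0≤1 : 0ℚ ≤ 1ℚ
0≤1 = from-yes (0ℚ ≤? 1ℚ)

-1≤1 : - 1ℚ ≤ 1ℚ
-1≤1 = from-yes (- 1ℚ ≤? 1ℚ)

threshold : Side → ℚ
threshold inside  = 1ℚ
threshold outside = 0ℚ

-1≤threshold : ∀ b → - 1ℚ ≤ threshold b
-1≤threshold inside  = -1≤1
-1≤threshold outside = -1≤0

0≤threshold : ∀ b → 0ℚ ≤ threshold b
0≤threshold inside  = 0≤1
0≤threshold outside = ≤-refl

1≤threshold⇔inside : ∀ b → 1ℚ ≤ threshold b ⇔ b ≡ inside
1≤threshold⇔inside inside  = mk⇔ (λ _ → refl) (λ _ → ≤-refl)
1≤threshold⇔inside outside = mk⇔ (λ 1≤0 → contradiction 1≤0 (from-no (1ℚ ≤? 0ℚ))) λ ()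

1≤threshold⇔∈ : ∀ {n} (A : Subset n) i → 1ℚ ≤ threshold (lookup A i) ⇔ i ∈ A
1≤threshold⇔∈ A i = mk⇔
  (λ 1≤a → lookup⇒[]= i A (to (1≤threshold⇔inside (lookup A i)) 1≤a))
  (λ i∈A → from (1≤threshold⇔inside (lookup A i)) ([]=⇒lookup i∈A))

S : Vec Point 2
S = (1ℚ , - 1ℚ) ∷ (- 1ℚ , 1ℚ) ∷ []

S-injective : Injective _≡_ _≡_ (lookup S)
S-injective {zero}     {zero}     _ = refl
S-injective {suc zero} {suc zero} _ = refl
S-injective {zero}     {suc zero} e = contradiction (cong proj₁ e) (from-no (1ℚ ≟ - 1ℚ))
S-injective {suc zero} {zero}     e = contradiction (cong proj₁ e) (from-no (- 1ℚ ≟ 1ℚ))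

S-antidiagonal : ∀ i → proj₁ (lookup S i) ≡ - proj₂ (lookup S i)
S-antidiagonal zero       = refl
S-antidiagonal (suc zero) = refl

origin∈rect-S : origin ∈rect S
origin∈rect-S = (-1≤0 , 0≤1) , (-1≤0 , 0≤1)

quadrant : Subset 2 → Box
quadrant A = L (threshold (lookup A zero)) , L (threshold (lookup A (suc zero)))

origin∈quadrant : ∀ A → origin ∈B quadrant A
origin∈quadrant A = 0≤threshold (lookup A zero) , 0≤threshold (lookup A (suc zero))

S∈quadrant⇔∈ : ∀ A i → lookup S i ∈B quadrant A ⇔ i ∈ A
S∈quadrant⇔∈ A zero = mk⇔
  (λ (1≤a₁ , _) → to (1≤threshold⇔∈ A zero) 1≤a₁)
  (λ 0∈A → from (1≤threshold⇔∈ A zero) 0∈A , -1≤threshold (lookup A (suc zero)))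
S∈quadrant⇔∈ A (suc zero) = mk⇔
  (λ (_ , 1≤a₂) → to (1≤threshold⇔∈ A (suc zero)) 1≤a₂)
  (λ 1∈A → -1≤threshold (lookup A zero) , from (1≤threshold⇔∈ A (suc zero)) 1∈A)

lemma3 : Σ (Vec Point 2) ShattersNicely2
lemma3 = S , S-injective , S-antidiagonal , origin∈rect-S ,
  λ A → quadrant A , S∈quadrant⇔∈ A , origin∈quadrant A , tt , tt
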